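{- Let $(h,\gamma,\gamma')$ be a coherent triple, $\mathbb X=(X_i)_{i\in\mathbb Z}$ its gene and $(v_i)_{i\in\mathbb Z}$ its associated digit sequence. For all $i\in\mathbb Z$: if $X_i=\mathbf A$ then $v_i=0$; if $X_i=\mathbf{AB}$ then $v_i=0$; if $X_i=\mathbf B$ then $v_i=1$; if $X_i=\mathbf 0$ then $v_i\ge1$.
   Context: Let $p>2$ be a prime, $f\ge2$ an integer, $q=p^f$. A coherent triple is $(h,\gamma,\gamma')\in\mathbb Z/(q^2-1)\mathbb Z\times\mathbb Z/(q-1)\mathbb Z\times\mathbb Z/(q-1)\mathbb Z$ such that $h$ is not divisible by $q+1$ and $h\equiv\gamma+\gamma'+\frac{q-1}{p-1}\pmod{q-1}$. Gene of a coherent triple (values in the symbols $\{\mathbf A,\mathbf B,\mathbf{AB},\mathbf 0\}$). Fix integer representatives of $h,\gamma'$. Let $h_0,\dots,h_{f-1}\in\{0,\dots,p-1\}$ with $h\equiv 1+\sum_{i=0}^{f-1}h_ip^{f-1-i}\pmod{q+1}$, set $h_i=p-1-h_{i-f}$ for $f\le i\le 2f-1$, extend $2f$-periodically, and set $\iota_i=1$ if $h_i=p-1$, $\iota_i=0$ otherwise. Let $\nu=p^{f-1}+\dots+p$. For $0\le i\le 2f-1$ let $\alpha_i\in\{0,\dots,q-2\}$ with $\alpha_i\equiv\lfloor p^ih/(q+1)\rfloor-p^i\gamma'\pmod{q-1}$, and set $X_i=\mathbf A$ if $\alpha_i<\frac1p\nu+\iota_{i+f}$; $X_i=\mathbf{AB}$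 if $\frac1p\nu+\iota_{i+f}\le\alpha_i\le\frac{p-1}{p}\nu-\iota_i$; $X_i=\mathbf B$ if $\frac{p-1}p\nu-\iota_i<\alpha_i\le\nu$; $X_i=\mathbf 0$ if $\alpha_i>\nu$; extend $2f$-periodically. Digit sequence: $v_0,\dots,v_{2f-1}\in\{0,\dots,p-1\}$ are defined by $h-(q+1)\gamma'\equiv\sum_{i=0}^{2f-1}v_ip^{2f-1-i}\pmod{q^2-1}$, and $v_i=v_{i\bmod 2f}$ for $i\in\mathbb Z$. -}

module Defs where

open import Data.Nat using (ℕ; zero; suc; _+_; _*_; _∸_; _^_; _≤_; _<_; _<ᵇ_; _≤ᵇ_; _≡ᵇ_)
import Data.Nat as ℕ
open import Data.Integer as ℤ using (ℤ; +_; _%ℕ_)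
open import Data.Bool using (Bool; true; false; if_then_else_; _∧_)
open import Data.List using (upTo; map)
open import Data.Nat.ListAction using (sum)
open import Data.Nat.Divisibility using (_∣_)
open import Data.Product using (_×_)
open import Relation.Nullary using (¬_)
open import Relation.Binary.PropositionalEquality using (_≡_)

-- Total versions of division / remainder (the divisor-zero case never
-- arises under the hypotheses of the statement; it is given a junk value).
divN : ℕ → ℕ → ℕ
divN m zero    = 0
divN m (suc n) = m ℕ./ suc n

modN : ℕ → ℕ → ℕ
modN m zero    = m
modN m (suc n) = m ℕ.% suc n

modZ : ℤ → ℕ → ℕ
modZ a zero    = 0
modZ a (suc n) = a %ℕ suc n

data Gene : Set where
  A B AB O : Gene

module _ (p f : ℕ) where

  q : ℕ
  q = p ^ f

  ν : ℕ
  ν = sum (map (λ j → p ^ suc j) (upTo (f ∸ 1)))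

  -- Coherent triple, with h ∈ ℤ/(q²-1), γ, γ' ∈ ℤ/(q-1) given by their
  -- canonical representatives (bounds are imposed in the statement).
  Coherent : ℕ → ℕ → ℕ → Set
  Coherent h γ γ' =
    ¬ (suc q ∣ h) ×
    modN h (q ∸ 1) ≡ modN (γ + γ' + divN (q ∸ 1) (p ∸ 1)) (q ∸ 1)

  module _ (h γ' : ℕ) where

    -- h_0,…,h_{f-1}: base-p digits of (h - 1) mod (q+1), i.e.
    -- h ≡ 1 + Σ h_i p^{f-1-i} (mod q+1)
    hdigit : ℕ → ℕ
    hdigit i = modN (divN (modN (h + q) (suc q)) (p ^ (f ∸ 1 ∸ i))) p

    hseq : ℕ → ℕ
    hseq j = let k = modN j (2 * f) in
      if k <ᵇ f then hdigit k else (p ∸ 1) ∸ hdigit (k ∸ f)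

    ι : ℕ → ℕ
    ι j = if hseq j ≡ᵇ (p ∸ 1) then 1 else 0

    α : ℕ → ℕ
    α i = modZ (+ divN (p ^ i * h) (suc q) ℤ.- + (p ^ i * γ')) (q ∸ 1)

    -- X_i for 0 ≤ i ≤ 2f-1; the conditions with 1/p ν are multiplied by p.
    --  A : α_i < ν/p + ι_{i+f}
    --  AB: ν/p + ι_{i+f} ≤ α_i ≤ (p-1)ν/p - ι_i
    --  B : (p-1)ν/p - ι_i < α_i ≤ ν
    --  0 : α_i > ν
    geneAt : ℕ → Gene
    geneAt i =
      if p * α i <ᵇ ν + p * ι (i + f) then A
      else if (ν + p * ι (i + f) ≤ᵇ p * α i) ∧ (p * (α i + ι i) ≤ᵇ (p ∸ 1) * ν) then AB
      else if ((p ∸ 1) * ν <ᵇ p * (α i + ι i)) ∧ (α i ≤ᵇ ν) then B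
      else O

    gene : ℤ → Gene
    gene i = geneAt (modZ i (2 * f))

    -- digits v_0,…,v_{2f-1} of (h - (q+1)γ') mod (q²-1), most significant first
    vdigit : ℕ → ℕ
    vdigit k = modN (divN (modZ (+ h ℤ.- + (suc q * γ')) (q * q ∸ 1)) (p ^ (2 * f ∸ 1 ∸ k))) p

    digit : ℤ → ℕ
    digit i = vdigit (modZ i (2 * f))

-- Write Q = q, P = p^(f-1) (so that p^(2f-1) = Q P), R_k = p^k h mod (Q+1) and
-- u_k = (Q+1) α_k + R_k. Since α_k ≡ ⌊p^k h/(Q+1)⌋ - p^k γ' (mod Q-1), multiplying by Q+1
-- gives u_k ≡ p^k (h - (Q+1) γ') (mod Q²-1), and 0 ≤ u_k < Q²-1. So u_k is the k-fold cyclic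
-- rotation of the 2f-digit base-p block (v_0 … v_{2f-1}), and v_k = ⌊u_k / (Q P)⌋.
-- Similarly, as p^f ≡ -1 (mod Q+1), R_k - 1 is a negacyclic rotation of the f-digit block
-- h - 1 mod (Q+1), with leading digit h_k; hence ι_k = 1 exactly when R_k > Q - P.
-- Together these give ⌊u_k / (Q P)⌋ = 0 iff α_k + ι_k < P, and the inequalities defining
-- the gene X_k (where ν = p (P-1)/(p-1)) decide on which side of P the sum α_k + ι_k lies;
-- for X_k = B the extra bound α_k ≤ ν keeps u_k below 2 Q P.

module Submission where

open import Data.Bool using (Bool; true; false; T; if_then_else_; _∧_)
open import Data.Bool.Properties using (T-∧)
open import Data.Empty using (⊥-elim)
open import Data.Integer as ℤ using (ℤ; _/ℕ_)
open import Data.Integer.DivMod using (a≡a%ℕn+[a/ℕn]*n; n%ℕd<d)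
open import Data.List using ([]; _∷_; _∷ʳ_; _++_; map; upTo)
open import Data.List.Properties using (upTo-∷ʳ; map-++)
open import Data.Nat as ℕ
  using (ℕ; zero; suc; _+_; _*_; _∸_; _^_; _≤_; _<_; z≤n; s≤s; z<s; NonZero; >-nonZero; >-nonZero⁻¹;
         _/_; _%_; _<ᵇ_; _≤ᵇ_)
open import Data.Nat.DivMod
open import Data.Nat.Divisibility using (_∣_; n∣m*n; m%n≡0⇒n∣m)
open import Data.Nat.ListAction using (sum)
open import Data.Nat.ListAction.Properties using (sum-++)
open import Data.Nat.Primality using (Prime)
open import Data.Nat.Properties
open import Data.Nat.Tactic.RingSolver using (solve-∀)
open import Algebra.Definitions.RawMagma ℕ.+-rawMagma using (_,_)
open import Data.Product using (∃-syntax; _×_; _,_; proj₁; proj₂)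
open import Data.Sum using (_⊎_; inj₁; inj₂)
open import Function using (_∘_; Equivalence)
open import Relation.Binary.PropositionalEquality
open import Relation.Nullary using (¬_; yes; no)
open import Defs

[m+kn]/n≡k : ∀ {m} k {n} .{{_ : NonZero n}} → m < n → (m + k * n) / n ≡ k
[m+kn]/n≡k {m} k {n} m<n = begin
  (m + k * n) / n   ≡⟨ +-distrib-/-∣ʳ m (n∣m*n k) ⟩
  m / n + k * n / n ≡⟨ cong₂ _+_ (m<n⇒m/n≡0 m<n) (m*n/n≡m k n) ⟩
  k                 ∎
  where open ≡-Reasoning

[m+kn]%n≡m : ∀ {m} k {n} .{{_ : NonZero n}} → m < n → (m + k * n) % n ≡ m
[m+kn]%n≡m {m} k {n} m<n = trans ([m+kn]%n≡m%n m k n) (m<n⇒m%n≡m m<n)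

[m*n+o]/[n*d]≡m/d : ∀ m {n o} d .{{_ : NonZero n}} .{{_ : NonZero d}} .{{_ : NonZero (n * d)}} →
                    o < n → (m * n + o) / (n * d) ≡ m / d
[m*n+o]/[n*d]≡m/d m {n} {o} d o<n = begin
  (m * n + o) / (n * d) ≡⟨ m/n/o≡m/[n*o] (m * n + o) n d ⟨
  (m * n + o) / n / d   ≡⟨ cong (_/ d) (trans (/-congˡ (+-comm (m * n) o)) ([m+kn]/n≡k m o<n)) ⟩
  m / d                 ∎
  where open ≡-Reasoning

m*n%d≡m*[n%d]%d : ∀ m n d .{{_ : NonZero d}} → m * n % d ≡ m * (n % d) % d
m*n%d≡m*[n%d]%d m n d = begin
  m * n % d                           ≡⟨ cong (λ x → m * x % d) (m≡m%n+[m/n]*n n d) ⟩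
  m * (n % d + n / d * d) % d         ≡⟨ cong (_% d) (split m (n % d) (n / d) d) ⟩
  (m * (n % d) + m * (n / d) * d) % d ≡⟨ [m+kn]%n≡m%n (m * (n % d)) (m * (n / d)) d ⟩
  m * (n % d) % d                     ∎
  where
  open ≡-Reasoning
  split : ∀ m r k d → m * (r + k * d) ≡ m * r + m * k * d
  split = solve-∀

m*n+o<p*n : ∀ {m n o p} → o < n → m < p → m * n + o < p * n
m*n+o<p*n {m} {n} {o} {p} o<n m<p = begin-strict
  m * n + o  <⟨ +-monoʳ-< (m * n) o<n ⟩
  m * n + n  ≡⟨ +-comm (m * n) n ⟩
  suc m * n  ≤⟨ *-monoˡ-≤ n m<p ⟩
  p * n      ∎
  where open ≤-Reasoning

m%[1+n]≡1+[m+n]%[1+n] : ∀ {m n} → ¬ suc n ∣ m → m % suc n ≡ suc ((m + n) % suc n)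
m%[1+n]≡1+[m+n]%[1+n] {m} {n} ∤m with m % suc n in eq
... | zero  = ⊥-elim (∤m (m%n≡0⇒n∣m m (suc n) eq))
... | suc r = cong suc (sym (begin
  (m + n) % suc n                  ≡⟨ %-distribˡ-+ m n (suc n) ⟩
  (m % suc n + n % suc n) % suc n  ≡⟨ cong₂ (λ a b → (a + b) % suc n) eq (m<n⇒m%n≡m (n<1+n n)) ⟩
  (suc r + n) % suc n              ≡⟨ cong (_% suc n) (+-suc r n) ⟨
  (r + suc n) % suc n              ≡⟨ [m+n]%n≡m%n r (suc n) ⟩
  r % suc n                        ≡⟨ m<n⇒m%n≡m (<-trans (n<1+n r) (subst (_< suc n) eq (m%n<n m (suc n)))) ⟩
  r                                ∎))
  where open ≡-Reasoning

complement-/ : ∀ {x b P} .{{_ : NonZero P}} → x < b * P → (b * P ∸ suc x) / P ≡ b ∸ 1 ∸ x / P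
complement-/ {x} {b} {P} x<bP
  with m≤n⇒∃[o]m+o≡n (m<n*o⇒m/o<n {x} {b} {P} x<bP) | m≤n⇒∃[o]m+o≡n (m%n<n x P)
... | w₁ , eq₁ | w₂ , eq₂ = begin
  (b * P ∸ suc x) / P                ≡⟨ /-congˡ (cong (_∸ suc x) split) ⟩
  (suc x + (w₂ + w₁ * P) ∸ suc x) / P ≡⟨ /-congˡ (m+n∸m≡n (suc x) (w₂ + w₁ * P)) ⟩
  (w₂ + w₁ * P) / P                  ≡⟨ [m+kn]/n≡k w₁ (subst (w₂ <_) eq₂ (s≤s (m≤n+m w₂ (x % P)))) ⟩
  w₁                                 ≡⟨ m+n∸m≡n (x / P) w₁ ⟨
  x / P + w₁ ∸ x / P                 ≡⟨ cong (_∸ x / P) (cong ℕ.pred eq₁) ⟩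
  b ∸ 1 ∸ x / P                      ∎
  where
  open ≡-Reasoning
  rearrange : ∀ r w₂ a P w₁ → suc r + w₂ + a * P + w₁ * P ≡ suc (r + a * P) + (w₂ + w₁ * P)
  rearrange = solve-∀
  split : b * P ≡ suc x + (w₂ + w₁ * P)
  split = begin
    b * P                                 ≡⟨ cong (_* P) eq₁ ⟨
    (suc (x / P) + w₁) * P                ≡⟨ *-distribʳ-+ P (suc (x / P)) w₁ ⟩
    P + x / P * P + w₁ * P                ≡⟨ cong (λ z → z + x / P * P + w₁ * P) eq₂ ⟨
    suc (x % P) + w₂ + x / P * P + w₁ * P ≡⟨ rearrange (x % P) w₂ (x / P) P w₁ ⟩
    suc (x % P + x / P * P) + (w₂ + w₁ * P) ≡⟨ cong (λ z → suc z + (w₂ + w₁ * P)) (m≡m%n+[m/n]*n x P) ⟨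
    suc x + (w₂ + w₁ * P)                 ∎

top-digit-max : ∀ {x b P} .{{_ : NonZero P}} → x / P ≡ b ∸ 1 → b * P ≤ x + P
top-digit-max {b = zero}            _    = z≤n
top-digit-max {x} {b = suc b} {P} x/P≡b = begin
  P + b * P      ≡⟨ cong (λ z → P + z * P) x/P≡b ⟨
  P + x / P * P  ≤⟨ +-monoʳ-≤ P (m/n*n≤m x P) ⟩
  P + x          ≡⟨ +-comm P x ⟩
  x + P          ∎
  where open ≤-Reasoning

top-digit-not-max : ∀ {x b P} .{{_ : NonZero P}} → x < b * P → x / P ≢ b ∸ 1 → suc x + P ≤ b * P
top-digit-not-max {x} {suc b} {P} x<bP x/P≢b = begin
  suc x + P                  ≤⟨ +-monoˡ-≤ P x<next ⟩
  suc (x / P) * P + P        ≤⟨ +-monoˡ-≤ P (*-monoˡ-≤ P x/P<b) ⟩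
  b * P + P                  ≡⟨ +-comm (b * P) P ⟩
  suc b * P                  ∎
  where
  open ≤-Reasoning
  x/P<b : x / P < b
  x/P<b = ≤∧≢⇒< (≤-pred (m<n*o⇒m/o<n x<bP)) x/P≢b
  x<next : x < suc (x / P) * P
  x<next = subst (_< P + x / P * P) (sym (m≡m%n+[m/n]*n x P)) (+-monoˡ-< (x / P * P) (m%n<n x P))

-- The complement c*d ∸ 1 ∸ (b + a*d) has the digits d ∸ 1 ∸ b and c ∸ 1 ∸ a; it is nonzero,
-- so one of these digits is.
digit-swap-< : ∀ {a b c d} → a < c → b < d → suc (b + a * d) < c * d → suc (b * c + a) < c * d
digit-swap-< {a} {b} a<c b<d lt with ≤⇒≤″ a<c | ≤⇒≤″ b<d
... | suc a′ , refl | b′ , refl = ≤″⇒≤ (a′ + b′ * (suc a + suc a′) , eq a b a′ b′)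
  where
  eq : ∀ a b a′ b′ → suc (suc (b * (suc a + suc a′) + a)) + (a′ + b′ * (suc a + suc a′))
                   ≡ (suc a + suc a′) * (suc b + b′)
  eq = solve-∀
... | zero , refl | suc b′ , refl = ≤″⇒≤ (a + (suc a + 0) * b′ , eq a b b′)
  where
  eq : ∀ a b b′ → suc (suc (b * (suc a + 0) + a)) + (a + (suc a + 0) * b′)
                ≡ (suc a + 0) * (suc b + suc b′)
  eq = solve-∀
... | zero , refl | zero , refl = ⊥-elim (<-irrefl (eq a b) lt)
  where
  eq : ∀ a b → suc (b + a * (suc b + 0)) ≡ (suc a + 0) * (suc b + 0)
  eq = solve-∀

rotate-cyclic : ∀ {c d n} N .{{_ : NonZero d}} .{{_ : NonZero n}} →
                c * d ≡ suc n → N < n → c * N % n ≡ N % d * c + N / d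
rotate-cyclic {c} {d} {n} N cd≡1+n N<n = begin
  c * N % n                               ≡⟨ cong (λ x → c * x % n) (m≡m%n+[m/n]*n N d) ⟩
  c * (N % d + N / d * d) % n             ≡⟨ cong (_% n) (expand (N % d) (N / d)) ⟩
  (N % d * c + N / d + N / d * n) % n     ≡⟨ [m+kn]%n≡m (N / d) swapped<n ⟩
  N % d * c + N / d                       ∎
  where
  open ≡-Reasoning
  shape : ∀ b a c d n → c * (b + a * d) ≡ b * c + a * (c * d)
  shape = solve-∀
  expand : ∀ b a → c * (b + a * d) ≡ b * c + a + a * n
  expand b a = begin
    c * (b + a * d)       ≡⟨ shape b a c d n ⟩
    b * c + a * (c * d)   ≡⟨ cong (λ x → b * c + a * x) cd≡1+n ⟩
    b * c + a * suc n     ≡⟨ cong (b * c +_) (*-suc a n) ⟩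
    b * c + (a + a * n)   ≡⟨ +-assoc (b * c) a (a * n) ⟨
    b * c + a + a * n     ∎
  N<cd : N < c * d
  N<cd = subst (N <_) (sym cd≡1+n) (<-trans N<n (n<1+n n))
  swapped<n : N % d * c + N / d < n
  swapped<n = ≤-pred (subst (suc (N % d * c + N / d) <_) cd≡1+n
    (digit-swap-< (m<n*o⇒m/o<n N<cd) (m%n<n N d)
      (subst (_< c * d) (cong suc (m≡m%n+[m/n]*n N d)) (subst (suc N <_) (sym cd≡1+n) (s≤s N<n)))))

digit-by-rotation : ∀ {b c d n} N .{{_ : NonZero b}} .{{_ : NonZero d}} {{_ : NonZero (b * d)}}
                    .{{_ : NonZero c}} .{{_ : NonZero (c * d)}} .{{_ : NonZero n}} →
                    c * (b * d) ≡ suc n → N < n → c * N % n / (c * d) ≡ N / d % b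
digit-by-rotation {b} {c} {d} {n} N cbd≡1+n N<n = begin
  c * N % n / (c * d)                          ≡⟨ /-congˡ (rotate-cyclic {c} {b * d} N cbd≡1+n N<n) ⟩
  (N % (b * d) * c + N / (b * d)) / (c * d)    ≡⟨ [m*n+o]/[n*d]≡m/d (N % (b * d)) d leading<c ⟩
  N % (b * d) / d                              ≡⟨ m%[n*o]/o≡m/o%n N b d ⟩
  N / d % b                                    ∎
  where
  open ≡-Reasoning
  leading<c : N / (b * d) < c
  leading<c = m<n*o⇒m/o<n (subst (N <_) (sym cbd≡1+n) (<-trans N<n (n<1+n n)))

-- Multiplying by c rotates the digit block s = (a, b) (base d) modulo c*d + 1, where the
-- wrapped-around digit a enters negated as c - 1 - a, since c*d ≡ -1.
rotate-negacyclic : ∀ {c d n} s .{{_ : NonZero d}} →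
                    c * d ≡ n → s < n → c * suc s % suc n ≡ suc (s % d * c + (c ∸ suc (s / d)))
rotate-negacyclic {c} {d} {n} s cd≡n s<n
  with m≤n⇒∃[o]m+o≡n (m<n*o⇒m/o<n {s} {c} {d} (subst (s <_) (sym cd≡n) s<n))
... | y , refl = begin
  (suc a + y) * suc s % suc n                         ≡⟨ cong (λ x → (suc a + y) * suc x % suc n) (m≡m%n+[m/n]*n s d) ⟩
  (suc a + y) * suc (b + a * d) % suc n               ≡⟨ cong (_% suc n) (expand a y b d) ⟩
  (suc (b * (suc a + y) + y) + a * suc ((suc a + y) * d)) % suc n
                                                      ≡⟨ cong (λ x → (suc (b * (suc a + y) + y) + a * suc x) % suc n) cd≡n ⟩
  (suc (b * (suc a + y) + y) + a * suc n) % suc n     ≡⟨ [m+kn]%n≡m a (s≤s rotated<n) ⟩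
  suc (b * (suc a + y) + y)                           ≡⟨ cong (λ x → suc (b * (suc a + y) + x)) (m+n∸m≡n (suc a) y) ⟨
  suc (b * (suc a + y) + (suc a + y ∸ suc a))         ∎
  where
  open ≡-Reasoning
  a b : ℕ
  a = s / d
  b = s % d
  expand : ∀ a y b d → (suc a + y) * suc (b + a * d) ≡ suc (b * (suc a + y) + y) + a * suc ((suc a + y) * d)
  expand = solve-∀
  rotated<n : b * (suc a + y) + y < n
  rotated<n = subst (b * (suc a + y) + y <_) (trans (*-comm d (suc a + y)) cd≡n)
                (m*n+o<p*n (s≤s (m≤n+m y a)) (m%n<n s d))

[1+Q]*α+R<Q*P : ∀ {Q P α R} → suc (suc α) ≤ P → suc α < Q → R ≤ Q → suc (suc Q * α + R) < Q * P
[1+Q]*α+R<Q*P {Q} {P} {α} {R} α+2≤P 1+α<Q R≤Q = begin-strict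
  suc (suc Q * α + R)      ≤⟨ s≤s (+-monoʳ-≤ (suc Q * α) R≤Q) ⟩
  suc (suc Q * α + Q)      ≡⟨ regroup Q α ⟩
  Q * suc α + suc α        <⟨ +-monoʳ-< (Q * suc α) 1+α<Q ⟩
  Q * suc α + Q            ≡⟨ trans (*-suc Q (suc α)) (+-comm Q (Q * suc α)) ⟨
  Q * suc (suc α)          ≤⟨ *-monoʳ-≤ Q α+2≤P ⟩
  Q * P                    ∎
  where
  open ≤-Reasoning
  regroup : ∀ Q α → suc (suc Q * α + Q) ≡ Q * suc α + suc α
  regroup = solve-∀

[1+Q]*α+R<Q*P′ : ∀ {Q P α R} → suc α ≤ P → R + P ≤ Q → suc Q * α + R < Q * P
[1+Q]*α+R<Q*P′ {Q} {P} {α} {R} α<P R+P≤Q = begin-strict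
  suc Q * α + R      ≡⟨ regroup Q α R ⟩
  Q * α + (α + R)    <⟨ +-monoʳ-< (Q * α) (≤-trans (+-monoˡ-< R α<P) (≤-reflexive (+-comm P R))) ⟩
  Q * α + (R + P)    ≤⟨ +-monoʳ-≤ (Q * α) R+P≤Q ⟩
  Q * α + Q          ≡⟨ trans (*-suc Q α) (+-comm Q (Q * α)) ⟨
  Q * suc α          ≤⟨ *-monoʳ-≤ Q α<P ⟩
  Q * P              ∎
  where
  open ≤-Reasoning
  regroup : ∀ Q α R → suc Q * α + R ≡ Q * α + (α + R)
  regroup = solve-∀

Q*P≤[1+Q]*α+R : ∀ {Q P α R} → P ≤ α → Q * P ≤ suc Q * α + R
Q*P≤[1+Q]*α+R {Q} {P} {α} {R} P≤α = begin
  Q * P            ≤⟨ *-monoʳ-≤ Q P≤α ⟩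
  Q * α            ≤⟨ m≤n+m (Q * α) α ⟩
  suc Q * α        ≤⟨ m≤m+n (suc Q * α) R ⟩
  suc Q * α + R    ∎
  where open ≤-Reasoning

Q*P≤[1+Q]*α+R′ : ∀ {Q P α R} → P ≤ suc α → Q < R + P → Q * P ≤ suc Q * α + R
Q*P≤[1+Q]*α+R′ {Q} {P} {α} {R} P≤1+α Q<R+P = begin
  Q * P            ≤⟨ *-monoʳ-≤ Q P≤1+α ⟩
  Q * suc α        ≡⟨ *-suc Q α ⟩
  Q + Q * α        ≤⟨ +-monoˡ-≤ (Q * α) Q≤R+α ⟩
  R + α + Q * α    ≡⟨ regroup Q α R ⟩
  suc Q * α + R    ∎
  where
  open ≤-Reasoning
  Q≤R+α : Q ≤ R + α
  Q≤R+α = ≤-pred (≤-trans Q<R+P (≤-trans (+-monoʳ-≤ R P≤1+α) (≤-reflexive (+-suc R α))))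
  regroup : ∀ Q α R → R + α + Q * α ≡ suc Q * α + R
  regroup = solve-∀

repunit : ℕ → ℕ → ℕ
repunit b zero    = 0
repunit b (suc n) = repunit b n + b ^ n

sum-map-^suc-upTo : ∀ b n → sum (map (λ j → b ^ suc j) (upTo n)) ≡ b * repunit b n
sum-map-^suc-upTo b zero    = sym (*-zeroʳ b)
sum-map-^suc-upTo b (suc n) = begin
  sum (map g (upTo (suc n)))              ≡⟨ cong (sum ∘ map g) (upTo-∷ʳ n) ⟨
  sum (map g (upTo n ∷ʳ n))               ≡⟨ cong sum (map-++ g (upTo n) (n ∷ [])) ⟩
  sum (map g (upTo n) ++ g n ∷ [])        ≡⟨ sum-++ (map g (upTo n)) (g n ∷ []) ⟩
  sum (map g (upTo n)) + (b ^ suc n + 0)  ≡⟨ cong (_+ (b ^ suc n + 0)) (sum-map-^suc-upTo b n) ⟩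
  b * repunit b n + (b * b ^ n + 0)       ≡⟨ collect (repunit b n) (b ^ n) b ⟩
  b * (repunit b n + b ^ n)               ∎
  where
  open ≡-Reasoning
  g : ℕ → ℕ
  g j = b ^ suc j
  collect : ∀ r x b → b * r + (b * x + 0) ≡ b * (r + x)
  collect = solve-∀

[b-1]*repunit+1≡b^n : ∀ b n .{{_ : NonZero b}} → (b ∸ 1) * repunit b n + 1 ≡ b ^ n
[b-1]*repunit+1≡b^n (suc b) zero    = cong (_+ 1) (*-zeroʳ b)
[b-1]*repunit+1≡b^n (suc b) (suc n) = begin
  b * (repunit (suc b) n + suc b ^ n) + 1     ≡⟨ regroup b (repunit (suc b) n) (suc b ^ n) ⟩
  b * repunit (suc b) n + 1 + b * suc b ^ n   ≡⟨ cong (_+ b * suc b ^ n) ([b-1]*repunit+1≡b^n (suc b) n) ⟩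
  suc b ^ n + b * suc b ^ n                   ∎
  where
  open ≡-Reasoning
  regroup : ∀ b r x → b * (r + x) + 1 ≡ b * r + 1 + b * x
  regroup = solve-∀

repunit>0 : ∀ b n .{{_ : NonZero b}} → 0 < n → 0 < repunit b n
repunit>0 b (suc n) _ = ≤-trans (>-nonZero⁻¹ (b ^ n) {{m^n≢0 b n}}) (m≤n+m (b ^ n) (repunit b n))

repunit+2≤b^n : ∀ b n → 2 < b → 0 < n → repunit b n + 2 ≤ b ^ n
repunit+2≤b^n b@(suc (suc (suc t))) n (s≤s (s≤s (s≤s _))) 0<n with m≤n⇒∃[o]m+o≡n (repunit>0 b n 0<n)
... | r , eq = begin
  repunit b n + 2                      ≡⟨ cong (_+ 2) eq ⟨
  suc r + 2                            ≤⟨ ≤″⇒≤ (r + t * suc r , grow t r) ⟩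
  (2 + t) * suc r + 1                  ≡⟨ cong (λ x → (2 + t) * x + 1) eq ⟩
  (2 + t) * repunit b n + 1            ≡⟨ [b-1]*repunit+1≡b^n b n ⟩
  b ^ n                                ∎
  where
  open ≤-Reasoning
  grow : ∀ t r → suc r + 2 + (r + t * suc r) ≡ (2 + t) * suc r + 1
  grow = solve-∀

2+b*repunit≤b^n+b^n : ∀ b n → 1 < b → 2 + b * repunit b n ≤ b ^ n + b ^ n
2+b*repunit≤b^n+b^n b@(suc (suc t)) n (s≤s (s≤s _)) = begin
  2 + b * repunit b n                                        ≤⟨ ≤″⇒≤ (t * repunit b n , grow t (repunit b n)) ⟩
  ((1 + t) * repunit b n + 1) + ((1 + t) * repunit b n + 1)  ≡⟨ cong₂ _+_ b^n≡ b^n≡ ⟩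
  b ^ n + b ^ n                                              ∎
  where
  open ≤-Reasoning
  b^n≡ : (1 + t) * repunit b n + 1 ≡ b ^ n
  b^n≡ = [b-1]*repunit+1≡b^n b n
  grow : ∀ t r → 2 + (2 + t) * r + t * r ≡ ((1 + t) * r + 1) + ((1 + t) * r + 1)
  grow = solve-∀

module _ where
  open import Data.Integer using (+_; -[1+_]; 1ℤ)
  open import Data.Integer.Properties using (pos-+; pos-*; +-injective; neg-distribˡ-*; [+m]-[+n]≡m⊖n; ⊖-≥)
  import Data.Integer.Tactic.RingSolver as ℤ-Solver

  +-∸ : ∀ {m n} → n ≤ m → + (m ∸ n) ≡ + m ℤ.- + n
  +-∸ {m} {n} n≤m = sym (trans ([+m]-[+n]≡m⊖n m n) (⊖-≥ n≤m))

  +-linear : ∀ m k n → + m ℤ.+ + k ℤ.* + n ≡ + (m + k * n)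
  +-linear m k n = trans (cong (λ x → + m ℤ.+ x) (sym (pos-* k n))) (sym (pos-+ m (k * n)))

  ≡+⇒≡- : ∀ {a} b c → a ≡ b ℤ.+ c → b ≡ a ℤ.- c
  ≡+⇒≡- b c refl = sym (cancel b c)
    where
    cancel : ∀ b c → b ℤ.+ c ℤ.- c ≡ b
    cancel = ℤ-Solver.solve-∀

  ≡-⇒≡+ : ∀ {a} b c → a ≡ b ℤ.- c → b ≡ a ℤ.+ c
  ≡-⇒≡+ b c refl = sym (cancel b c)
    where
    cancel : ∀ b c → b ℤ.- c ℤ.+ c ≡ b
    cancel = ℤ-Solver.solve-∀

  %-as-difference : ∀ m n .{{_ : NonZero n}} → + (m % n) ≡ + m ℤ.- + (m / n) ℤ.* + n
  %-as-difference m n = ≡+⇒≡- (+ (m % n)) (+ (m / n) ℤ.* + n) (a≡a%ℕn+[a/ℕn]*n (+ m) n)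

  modZ-as-difference : ∀ a n .{{_ : NonZero n}} → + modZ a n ≡ a ℤ.- (a /ℕ n) ℤ.* + n
  modZ-as-difference a (suc n) = ≡+⇒≡- (+ modZ a (suc n)) ((a /ℕ suc n) ℤ.* + suc n) (a≡a%ℕn+[a/ℕn]*n a (suc n))

  congruent⇒%≡ : ∀ {u v n} .{{_ : NonZero n}} → (∃[ t ] + u ≡ + v ℤ.+ t ℤ.* + n) → u % n ≡ v % n
  congruent⇒%≡ {u} {v} {n} (+ j , eq) =
    trans (cong (_% n) (+-injective (trans eq (+-linear v j n)))) ([m+kn]%n≡m%n v j n)
  congruent⇒%≡ {u} {v} {n} (-[1+ j ] , eq) =
    sym (trans (cong (_% n) (+-injective (trans (≡-⇒≡+ (+ v) (+ suc j ℤ.* + n) eq′) (+-linear u (suc j) n)))) ([m+kn]%n≡m%n u (suc j) n))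
    where
    eq′ : + u ≡ + v ℤ.- + suc j ℤ.* + n
    eq′ = trans eq (cong (λ x → + v ℤ.+ x) (sym (neg-distribˡ-* (+ suc j) (+ n))))

  -- The factor Q+1 lifts the congruence for α modulo Q-1 to one modulo Q²-1.
  [1+Q]*α+R≡c*N : ∀ {Q c h γ D α R N} s t → 1 ≤ Q →
                  + α ≡ (+ D ℤ.- + (c * γ)) ℤ.- s ℤ.* + (Q ∸ 1) →
                  + R ≡ + (c * h) ℤ.- + D ℤ.* + suc Q →
                  + N ≡ (+ h ℤ.- + (suc Q * γ)) ℤ.- t ℤ.* + (Q * Q ∸ 1) →
                  ∃[ T ] + (suc Q * α + R) ≡ + (c * N) ℤ.+ T ℤ.* + (Q * Q ∸ 1)
  [1+Q]*α+R≡c*N {Q} {c} {h} {γ} {D} {α} {R} {N} s t 1≤Q α≡ R≡ N≡ = + c ℤ.* t ℤ.- s , (begin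
    + (suc Q * α + R)
      ≡⟨ pos-+ (suc Q * α) R ⟩
    + (suc Q * α) ℤ.+ + R
      ≡⟨ cong₂ ℤ._+_ (trans (pos-* (suc Q) α) (cong (Q₊ ℤ.*_) α≡′)) R≡′ ⟩
    Q₊ ℤ.* ((+ D ℤ.- ĉ ℤ.* + γ) ℤ.- s ℤ.* (+ Q ℤ.- 1ℤ)) ℤ.+ (ĉ ℤ.* + h ℤ.- + D ℤ.* Q₊)
      ≡⟨ identity (+ Q) ĉ (+ h) (+ γ) (+ D) s t ⟩
    ĉ ℤ.* ((+ h ℤ.- Q₊ ℤ.* + γ) ℤ.- t ℤ.* Q²₋) ℤ.+ (ĉ ℤ.* t ℤ.- s) ℤ.* Q²₋
      ≡⟨ cong₂ (λ x m → ĉ ℤ.* x ℤ.+ (ĉ ℤ.* t ℤ.- s) ℤ.* m) N≡′ Q²₋≡ ⟨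
    ĉ ℤ.* + N ℤ.+ (ĉ ℤ.* t ℤ.- s) ℤ.* + (Q * Q ∸ 1)
      ≡⟨ cong (λ x → x ℤ.+ (ĉ ℤ.* t ℤ.- s) ℤ.* + (Q * Q ∸ 1)) (pos-* c N) ⟨
    + (c * N) ℤ.+ (ĉ ℤ.* t ℤ.- s) ℤ.* + (Q * Q ∸ 1)
      ∎)
    where
    open ≡-Reasoning
    ĉ Q₊ Q²₋ : ℤ
    ĉ = + c
    Q₊ = 1ℤ ℤ.+ + Q
    Q²₋ = + Q ℤ.* + Q ℤ.- 1ℤ
    identity : ∀ Q c h γ D s t →
      (1ℤ ℤ.+ Q) ℤ.* ((D ℤ.- c ℤ.* γ) ℤ.- s ℤ.* (Q ℤ.- 1ℤ)) ℤ.+ (c ℤ.* h ℤ.- D ℤ.* (1ℤ ℤ.+ Q))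
        ≡ c ℤ.* ((h ℤ.- (1ℤ ℤ.+ Q) ℤ.* γ) ℤ.- t ℤ.* (Q ℤ.* Q ℤ.- 1ℤ)) ℤ.+ (c ℤ.* t ℤ.- s) ℤ.* (Q ℤ.* Q ℤ.- 1ℤ)
    identity = ℤ-Solver.solve-∀
    Q²₋≡ : + (Q * Q ∸ 1) ≡ Q²₋
    Q²₋≡ = trans (+-∸ (*-mono-≤ 1≤Q 1≤Q)) (cong (ℤ._- 1ℤ) (pos-* Q Q))
    α≡′ : + α ≡ (+ D ℤ.- ĉ ℤ.* + γ) ℤ.- s ℤ.* (+ Q ℤ.- 1ℤ)
    α≡′ = trans α≡ (cong₂ (λ x y → (+ D ℤ.- x) ℤ.- s ℤ.* y) (pos-* c γ) (+-∸ 1≤Q))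
    R≡′ : + R ≡ ĉ ℤ.* + h ℤ.- + D ℤ.* Q₊
    R≡′ = trans R≡ (cong (λ x → x ℤ.- + D ℤ.* Q₊) (pos-* c h))
    N≡′ : + N ≡ (+ h ℤ.- Q₊ ℤ.* + γ) ℤ.- t ℤ.* Q²₋
    N≡′ = trans N≡ (cong₂ (λ x y → (+ h ℤ.- x) ℤ.- t ℤ.* y) (pos-* (suc Q) γ) Q²₋≡)

if-T : ∀ {a} {A : Set a} {b} {x y : A} → T b → (if b then x else y) ≡ x
if-T {b = true} _ = refl

if-¬T : ∀ {a} {A : Set a} {b} {x y : A} → ¬ T b → (if b then x else y) ≡ y
if-¬T {b = true}  ¬t = ⊥-elim (¬t _)
if-¬T {b = false} _  = refl

if-then-1-else-0≤1 : ∀ b → (if b then 1 else 0) ≤ 1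
if-then-1-else-0≤1 true  = ≤-refl
if-then-1-else-0≤1 false = z≤n

divN≡/ : ∀ m n .{{_ : NonZero n}} → divN m n ≡ m / n
divN≡/ m (suc n) = refl

modN≡% : ∀ m n .{{_ : NonZero n}} → modN m n ≡ m % n
modN≡% m (suc n) = refl

modZ<n : ∀ a n .{{_ : NonZero n}} → modZ a n < n
modZ<n a (suc n) = n%ℕd<d a (suc n)

classify : Bool → Bool → Bool → Gene
classify b₁ b₂ b₃ = if b₁ then A else if b₂ then AB else if b₃ then B else O

classify≡A : ∀ b₁ b₂ b₃ → classify b₁ b₂ b₃ ≡ A → T b₁
classify≡A true  _     _     _  = _
classify≡A false true  _     ()
classify≡A false false true  ()
classify≡A false false false ()

classify≡AB : ∀ b₁ b₂ b₃ → classify b₁ b₂ b₃ ≡ AB → T b₂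
classify≡AB true  _     _     ()
classify≡AB false true  _     _  = _
classify≡AB false false true  ()
classify≡AB false false false ()

classify≡B : ∀ b₁ b₂ b₃ → classify b₁ b₂ b₃ ≡ B → T b₃
classify≡B true  _     _     ()
classify≡B false true  _     ()
classify≡B false false true  _  = _
classify≡B false false false ()

classify≡O : ∀ b₁ b₂ b₃ → classify b₁ b₂ b₃ ≡ O → ¬ T b₁ × ¬ T b₂
classify≡O true  _     _     ()
classify≡O false true  _     ()
classify≡O false false true  ()
classify≡O false false false _  = (λ ()) , (λ ())

module GeneDigits (p e : ℕ) (2<p : 2 < p) (0<e : 0 < e) (h γ′ : ℕ) where

  f Q P n : ℕ
  f = suc e
  Q = q p f
  P = p ^ e
  n = Q * Q ∸ 1

  instance
    p≢0 : NonZero p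
    p≢0 = >-nonZero (<-trans z<s 2<p)
    P≢0 : NonZero P
    P≢0 = m^n≢0 p e
    Q≢0 : NonZero Q
    Q≢0 = m^n≢0 p f
    QP≢0 : NonZero (Q * P)
    QP≢0 = m*n≢0 Q P
    QQ≢0 : NonZero (Q * Q)
    QQ≢0 = m*n≢0 Q Q

  1<Q : 1 < Q
  1<Q = ≤-trans (<⇒≤ 2<p) (m≤m*n p P)

  instance
    Q∸1≢0 : NonZero (Q ∸ 1)
    Q∸1≢0 = >-nonZero (m<n⇒0<n∸m 1<Q)
    n≢0 : NonZero n
    n≢0 = >-nonZero (m<n⇒0<n∸m (≤-trans 1<Q (m≤m*n Q Q)))

  R u : ℕ → ℕ
  R k = p ^ k * h % suc Q
  u k = suc Q * α p f h γ′ k + R k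

  N : ℕ
  N = modZ (ℤ.+ h ℤ.- ℤ.+ (suc Q * γ′)) n

  LeadingDigit : ℕ → ℕ → Set
  LeadingDigit k d = ∃[ x ] R k ≡ suc x × x / P ≡ d

  R≤Q : ∀ k → R k ≤ Q
  R≤Q k = ≤-pred (m%n<n (p ^ k * h) (suc Q))

  1+α<Q : ∀ k → suc (α p f h γ′ k) < Q
  1+α<Q k = m≤pred[n]⇒suc[m]≤n (modZ<n _ (Q ∸ 1))

  u<n : ∀ k → u k < n
  u<n k = suc[m]≤n⇒m≤pred[n] ([1+Q]*α+R<Q*P (1+α<Q k) (1+α<Q k) (R≤Q k))

  u≡p^k*N%n : ∀ k → u k ≡ p ^ k * N % n
  u≡p^k*N%n k = begin
    u k               ≡⟨ m<n⇒m%n≡m (u<n k) ⟨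
    u k % n           ≡⟨ congruent⇒%≡ ([1+Q]*α+R≡c*N {Q} {p ^ k} {h} {γ′} {p ^ k * h / suc Q} (a /ℕ (Q ∸ 1)) (b /ℕ n) (<⇒≤ 1<Q)
                           (modZ-as-difference a (Q ∸ 1)) (%-as-difference (p ^ k * h) (suc Q))
                           (modZ-as-difference b n)) ⟩
    p ^ k * N % n     ∎
    where
    open ≡-Reasoning
    a b : ℤ
    a = ℤ.+ (p ^ k * h / suc Q) ℤ.- ℤ.+ (p ^ k * γ′)
    b = ℤ.+ h ℤ.- ℤ.+ (suc Q * γ′)

  vdigit≡u/QP : ∀ {k} → k < 2 * f → vdigit p f h γ′ k ≡ u k / (Q * P)
  vdigit≡u/QP {k} k<2f = begin
    vdigit p f h γ′ k                    ≡⟨ trans (modN≡% _ p) (cong (_% p) (divN≡/ N (p ^ e′))) ⟩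
    N / p ^ e′ % p                       ≡⟨ digit-by-rotation {p} {p ^ k} {p ^ e′} {n} N p^k*p^[1+e′]≡1+n (modZ<n _ n) ⟨
    p ^ k * N % n / (p ^ k * p ^ e′)     ≡⟨ /-congʳ p^k*p^e′≡QP ⟩
    p ^ k * N % n / (Q * P)              ≡⟨ /-congˡ (u≡p^k*N%n k) ⟨
    u k / (Q * P)                        ∎
    where
    open ≡-Reasoning
    e′ : ℕ
    e′ = 2 * f ∸ 1 ∸ k
    instance
      _ : NonZero (p ^ e′)
      _ = m^n≢0 p e′
      _ : NonZero (p * p ^ e′)
      _ = m^n≢0 p (suc e′)
      _ : NonZero (p ^ k)
      _ = m^n≢0 p k
      _ : NonZero (p ^ k * p ^ e′)
      _ = m*n≢0 (p ^ k) (p ^ e′)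
    k+e′≡f+e : k + e′ ≡ f + e
    k+e′≡f+e = trans (m+[n∸m]≡n (suc[m]≤n⇒m≤pred[n] k<2f))
                     (trans (cong ℕ.pred (cong (f +_) (+-identityʳ f))) (+-comm e f))
    p^k*p^e′≡QP : p ^ k * p ^ e′ ≡ Q * P
    p^k*p^e′≡QP = begin
      p ^ k * p ^ e′   ≡⟨ ^-distribˡ-+-* p k e′ ⟨
      p ^ (k + e′)     ≡⟨ cong (p ^_) k+e′≡f+e ⟩
      p ^ (f + e)      ≡⟨ ^-distribˡ-+-* p f e ⟩
      Q * P            ∎
    p^k*p^[1+e′]≡1+n : p ^ k * (p * p ^ e′) ≡ suc n
    p^k*p^[1+e′]≡1+n = begin
      p ^ k * p ^ suc e′  ≡⟨ ^-distribˡ-+-* p k (suc e′) ⟨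
      p ^ (k + suc e′)    ≡⟨ cong (p ^_) (trans (+-suc k e′) (trans (cong suc k+e′≡f+e) (sym (+-suc f e)))) ⟩
      p ^ (f + f)         ≡⟨ ^-distribˡ-+-* p f f ⟩
      Q * Q               ≡⟨ suc-pred (Q * Q) ⟨
      suc n               ∎

  ν≡p*repunit : ν p f ≡ p * repunit p e
  ν≡p*repunit = sum-map-^suc-upTo p e

  [p-1]*ν+p≡p*P : (p ∸ 1) * ν p f + p ≡ p * P
  [p-1]*ν+p≡p*P = begin
    (p ∸ 1) * ν p f + p                ≡⟨ cong (λ x → (p ∸ 1) * x + p) ν≡p*repunit ⟩
    (p ∸ 1) * (p * repunit p e) + p    ≡⟨ regroup (p ∸ 1) p (repunit p e) ⟩
    p * ((p ∸ 1) * repunit p e + 1)    ≡⟨ cong (p *_) ([b-1]*repunit+1≡b^n p e) ⟩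
    p * P                              ∎
    where
    open ≡-Reasoning
    regroup : ∀ a p r → a * (p * r) + p ≡ p * (a * r + 1)
    regroup = solve-∀

  [p-1]*ν<p*x⇒P≤x : ∀ {x} → (p ∸ 1) * ν p f < p * x → P ≤ x
  [p-1]*ν<p*x⇒P≤x {x} lt = ≤-pred (*-cancelˡ-< p P (suc x) (begin-strict
    p * P                  ≡⟨ [p-1]*ν+p≡p*P ⟨
    (p ∸ 1) * ν p f + p    <⟨ +-monoˡ-< p lt ⟩
    p * x + p              ≡⟨ trans (*-suc p x) (+-comm p (p * x)) ⟨
    p * suc x              ∎))
    where open ≤-Reasoning

  u<2QP : ∀ {k} → α p f h γ′ k ≤ ν p f → u k < 2 * (Q * P)
  u<2QP {k} α≤ν = subst (u k <_) (double Q P)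
    (<⇒≤ ([1+Q]*α+R<Q*P 2+α≤P+P (1+α<Q k) (R≤Q k)))
    where
    double : ∀ Q P → Q * (P + P) ≡ 2 * (Q * P)
    double = solve-∀
    2+α≤P+P : 2 + α p f h γ′ k ≤ P + P
    2+α≤P+P = ≤-trans (+-monoʳ-≤ 2 α≤ν)
      (subst (λ x → 2 + x ≤ P + P) (sym ν≡p*repunit) (2+b*repunit≤b^n+b^n p e (<⇒≤ 2<p)))

  module _ {k : ℕ} where
    private
      a i i′ : ℕ
      a = α p f h γ′ k
      i = ι p f h γ′ k
      i′ = ι p f h γ′ (k + f)
      A-test AB-low AB-high B-low B-high : Bool
      A-test  = p * a <ᵇ ν p f + p * i′
      AB-low  = ν p f + p * i′ ≤ᵇ p * a
      AB-high = p * (a + i) ≤ᵇ (p ∸ 1) * ν p f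
      B-low   = (p ∸ 1) * ν p f <ᵇ p * (a + i)
      B-high  = a ≤ᵇ ν p f

    gene≡A⇒ : geneAt p f h γ′ k ≡ A → suc (a + i) ≤ P
    gene≡A⇒ g = begin
      suc (a + i)              ≤⟨ s≤s (+-mono-≤ a≤r (if-then-1-else-0≤1 _)) ⟩
      suc (repunit p e + 1)    ≡⟨ +-suc (repunit p e) 1 ⟨
      repunit p e + 2          ≤⟨ repunit+2≤b^n p e 2<p 0<e ⟩
      P                        ∎
      where
      open ≤-Reasoning
      pa<p[r+i′] : p * a < p * (repunit p e + i′)
      pa<p[r+i′] = subst (p * a <_) (trans (cong (_+ p * i′) ν≡p*repunit) (sym (*-distribˡ-+ p (repunit p e) i′)))
                     (<ᵇ⇒< _ _ (classify≡A A-test (AB-low ∧ AB-high) (B-low ∧ B-high) g))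
      a≤r : a ≤ repunit p e
      a≤r = ≤-pred (≤-trans (*-cancelˡ-< p a (repunit p e + i′) pa<p[r+i′])
                     (≤-trans (+-monoʳ-≤ (repunit p e) (if-then-1-else-0≤1 _)) (≤-reflexive (+-comm (repunit p e) 1))))

    gene≡AB⇒ : geneAt p f h γ′ k ≡ AB → suc (a + i) ≤ P
    gene≡AB⇒ g = *-cancelˡ-≤ p (begin
      p * suc (a + i)          ≡⟨ trans (*-suc p (a + i)) (+-comm p (p * (a + i))) ⟩
      p * (a + i) + p          ≤⟨ +-monoˡ-≤ p (≤ᵇ⇒≤ _ _ (proj₂ (Equivalence.to T-∧ (classify≡AB A-test (AB-low ∧ AB-high) (B-low ∧ B-high) g)))) ⟩
      (p ∸ 1) * ν p f + p      ≡⟨ [p-1]*ν+p≡p*P ⟩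
      p * P                    ∎)
      where open ≤-Reasoning

    gene≡B⇒ : geneAt p f h γ′ k ≡ B → P ≤ a + i × a ≤ ν p f
    gene≡B⇒ g with Equivalence.to T-∧ (classify≡B A-test (AB-low ∧ AB-high) (B-low ∧ B-high) g)
    ... | above , a≤ν = [p-1]*ν<p*x⇒P≤x (<ᵇ⇒< _ _ above) , ≤ᵇ⇒≤ _ _ a≤ν

    gene≡O⇒ : geneAt p f h γ′ k ≡ O → P ≤ a + i
    gene≡O⇒ g with classify≡O A-test (AB-low ∧ AB-high) (B-low ∧ B-high) g
    ... | not-A , not-AB = [p-1]*ν<p*x⇒P≤x (≰⇒> (not-AB ∘ both ∘ ≤⇒≤ᵇ))
      where
      both : T AB-high → T (AB-low ∧ AB-high)
      both t = Equivalence.from T-∧ (≤⇒≤ᵇ (≮⇒≥ {p * a} {ν p f + p * i′} (not-A ∘ <⇒<ᵇ)) , t)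

  module _ (q+1∤h : ¬ suc Q ∣ h) where

    -- s = (h - 1) mod (Q+1), written without truncated subtraction.
    s : ℕ
    s = (h + Q) % suc Q

    h%[1+Q]≡1+s : h % suc Q ≡ suc s
    h%[1+Q]≡1+s = m%[1+n]≡1+[m+n]%[1+n] q+1∤h

    s<Q : s < Q
    s<Q = ≤-pred (subst (_< suc Q) h%[1+Q]≡1+s (m%n<n h (suc Q)))

    R-first-half : ∀ {j} → j ≤ e → LeadingDigit j (hdigit p f h γ′ j)
    R-first-half {j} j≤e = x , R≡ , x/P≡
      where
      open ≡-Reasoning
      g c d : ℕ
      g = e ∸ j
      c = p ^ j
      d = p * p ^ g
      instance
        _ : NonZero (p ^ g)
        _ = m^n≢0 p g
        _ : NonZero d
        _ = m^n≢0 p (suc g)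
        _ : NonZero c
        _ = m^n≢0 p j
        _ : NonZero (c * p ^ g)
        _ = m*n≢0 c (p ^ g)
      x : ℕ
      x = s % d * c + (c ∸ suc (s / d))
      cd≡Q : c * d ≡ Q
      cd≡Q = trans (sym (^-distribˡ-+-* p j (suc g))) (cong (p ^_) (trans (+-suc j g) (cong suc (m+[n∸m]≡n j≤e))))
      s/d<c : s / d < c
      s/d<c = m<n*o⇒m/o<n (subst (s <_) (sym cd≡Q) s<Q)
      cp^g≡P : c * p ^ g ≡ P
      cp^g≡P = trans (sym (^-distribˡ-+-* p j g)) (cong (p ^_) (m+[n∸m]≡n j≤e))
      R≡ : R j ≡ suc x
      R≡ = begin
        c * h % suc Q            ≡⟨ m*n%d≡m*[n%d]%d c h (suc Q) ⟩
        c * (h % suc Q) % suc Q  ≡⟨ cong (λ y → c * y % suc Q) h%[1+Q]≡1+s ⟩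
        c * suc s % suc Q        ≡⟨ rotate-negacyclic s cd≡Q s<Q ⟩
        suc x                    ∎
      x/P≡ : x / P ≡ hdigit p f h γ′ j
      x/P≡ = begin
        x / P                    ≡⟨ /-congʳ cp^g≡P ⟨
        x / (c * p ^ g)          ≡⟨ [m*n+o]/[n*d]≡m/d (s % d) {c} (p ^ g) (∸-monoʳ-< {c} z<s s/d<c) ⟩
        s % d / p ^ g            ≡⟨ m%[n*o]/o≡m/o%n s p (p ^ g) ⟩
        s / p ^ g % p            ≡⟨ trans (modN≡% _ p) (cong (_% p) (divN≡/ s (p ^ g))) ⟨
        hdigit p f h γ′ j        ∎

    R-second-half : ∀ {j} → j ≤ e → LeadingDigit (f + j) (p ∸ 1 ∸ hdigit p f h γ′ j)
    R-second-half {j} j≤e with R-first-half j≤e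
    ... | x , R≡ , x/P≡ = Q ∸ suc x , R′≡ , trans (complement-/ {x} {p} x<Q) (cong (p ∸ 1 ∸_) x/P≡)
      where
      open ≡-Reasoning
      x<Q : x < Q
      x<Q = subst (_≤ Q) R≡ (R≤Q j)
      R′≡ : R (f + j) ≡ suc (Q ∸ suc x)
      R′≡ = begin
        p ^ (f + j) * h % suc Q                 ≡⟨ cong (_% suc Q) (trans (cong (_* h) (^-distribˡ-+-* p f j)) (*-assoc Q (p ^ j) h)) ⟩
        Q * (p ^ j * h) % suc Q                 ≡⟨ m*n%d≡m*[n%d]%d Q (p ^ j * h) (suc Q) ⟩
        Q * R j % suc Q                         ≡⟨ cong (λ y → Q * y % suc Q) R≡ ⟩
        Q * suc x % suc Q                       ≡⟨ rotate-negacyclic {Q} {1} x (*-identityʳ Q) x<Q ⟩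
        suc (x % 1 * Q + (Q ∸ suc (x / 1)))     ≡⟨ cong₂ (λ y z → suc (y * Q + (Q ∸ suc z))) (n%1≡0 x) (n/1≡n x) ⟩
        suc (Q ∸ suc x)                         ∎

    hseq≡ : ∀ {k} → k < 2 * f →
            hseq p f h γ′ k ≡ (if k <ᵇ f then hdigit p f h γ′ k else p ∸ 1 ∸ hdigit p f h γ′ (k ∸ f))
    hseq≡ k<2f = cong (λ k′ → if k′ <ᵇ f then hdigit p f h γ′ k′ else p ∸ 1 ∸ hdigit p f h γ′ (k′ ∸ f))
                      (m<n⇒m%n≡m k<2f)

    R-leading-digit : ∀ {k} → k < 2 * f → LeadingDigit k (hseq p f h γ′ k)
    R-leading-digit {k} k<2f with k <? f
    ... | yes k<f = subst (LeadingDigit k) (sym (trans (hseq≡ k<2f) (if-T (<⇒<ᵇ k<f))))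
                      (R-first-half (≤-pred k<f))
    ... | no k≮f  = subst₂ LeadingDigit (m+[n∸m]≡n (≮⇒≥ k≮f)) (sym (trans (hseq≡ k<2f) (if-¬T (k≮f ∘ <ᵇ⇒< k f))))
                      (R-second-half (≤-pred (m<n+o⇒m∸n<o k f k<f+f)))
      where
      k<f+f : k < f + f
      k<f+f = subst (k <_) (cong (f +_) (+-identityʳ f)) k<2f

    ι-spec : ∀ {k} → k < 2 * f → (ι p f h γ′ k ≡ 1 × Q < R k + P) ⊎ (ι p f h γ′ k ≡ 0 × R k + P ≤ Q)
    ι-spec {k} k<2f with R-leading-digit k<2f | hseq p f h γ′ k ≟ p ∸ 1
    ... | x , R≡ , x/P≡ | yes top =
      inj₁ (if-T (≡⇒≡ᵇ _ _ top) , subst (λ r → Q < r + P) (sym R≡) (s≤s (top-digit-max {x} {p} (trans x/P≡ top))))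
    ... | x , R≡ , x/P≡ | no ¬top =
      inj₂ (if-¬T (¬top ∘ ≡ᵇ⇒≡ _ _) , subst (λ r → r + P ≤ Q) (sym R≡)
             (top-digit-not-max {x} {p} (subst (_≤ Q) R≡ (R≤Q k)) (¬top ∘ trans (sym x/P≡))))

    module _ {k : ℕ} (k<2f : k < 2 * f) where
      private
        a i : ℕ
        a = α p f h γ′ k
        i = ι p f h γ′ k

      u<QP : suc (a + i) ≤ P → u k < Q * P
      u<QP bound with ι-spec k<2f
      ... | inj₁ (i≡1 , _) =
        <⇒≤ ([1+Q]*α+R<Q*P (subst (λ j → suc j ≤ P) (trans (cong (a +_) i≡1) (+-comm a 1)) bound) (1+α<Q k) (R≤Q k))
      ... | inj₂ (i≡0 , R+P≤Q) =
        [1+Q]*α+R<Q*P′ (subst (λ j → suc j ≤ P) (trans (cong (a +_) i≡0) (+-identityʳ a)) bound) R+P≤Q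

      QP≤u : P ≤ a + i → Q * P ≤ u k
      QP≤u bound with ι-spec k<2f
      ... | inj₁ (i≡1 , Q<R+P) =
        Q*P≤[1+Q]*α+R′ (subst (P ≤_) (trans (cong (a +_) i≡1) (+-comm a 1)) bound) Q<R+P
      ... | inj₂ (i≡0 , _) =
        Q*P≤[1+Q]*α+R {Q} {P} {a} {R k} (subst (P ≤_) (trans (cong (a +_) i≡0) (+-identityʳ a)) bound)

      digits-of-gene :
        (geneAt p f h γ′ k ≡ A  → vdigit p f h γ′ k ≡ 0) ×
        (geneAt p f h γ′ k ≡ AB → vdigit p f h γ′ k ≡ 0) ×
        (geneAt p f h γ′ k ≡ B  → vdigit p f h γ′ k ≡ 1) ×
        (geneAt p f h γ′ k ≡ O  → 1 ≤ vdigit p f h γ′ k)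
      digits-of-gene =
          (λ g → digit≡0 (u<QP (gene≡A⇒ {k} g)))
        , (λ g → digit≡0 (u<QP (gene≡AB⇒ {k} g)))
        , (λ g → digit≡1 (QP≤u (proj₁ (gene≡B⇒ {k} g))) (u<2QP {k} (proj₂ (gene≡B⇒ {k} g))))
        , (λ g → digit≥1 (QP≤u (gene≡O⇒ {k} g)))
        where
        v≡ : vdigit p f h γ′ k ≡ u k / (Q * P)
        v≡ = vdigit≡u/QP k<2f
        digit≡0 : u k < Q * P → vdigit p f h γ′ k ≡ 0
        digit≡0 lt = trans v≡ (m<n⇒m/n≡0 lt)
        digit≥1 : Q * P ≤ u k → 1 ≤ vdigit p f h γ′ k
        digit≥1 le = subst (1 ≤_) (sym v≡) (m≥n⇒m/n>0 le)
        digit≡1 : Q * P ≤ u k → u k < 2 * (Q * P) → vdigit p f h γ′ k ≡ 1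
        digit≡1 le lt = ≤-antisym (subst (_≤ 1) (sym v≡) (≤-pred (m<n*o⇒m/o<n lt))) (digit≥1 le)

lemma1p3p3 : (p f : ℕ) → Prime p → 2 < p → 2 ≤ f →
    (h γ γ' : ℕ) → h < q p f * q p f ∸ 1 → γ < q p f ∸ 1 → γ' < q p f ∸ 1 →
    Coherent p f h γ γ' →
    (i : ℤ) →
      (gene p f h γ' i ≡ A → digit p f h γ' i ≡ 0) ×
      (gene p f h γ' i ≡ AB → digit p f h γ' i ≡ 0) ×
      (gene p f h γ' i ≡ B → digit p f h γ' i ≡ 1) ×
      (gene p f h γ' i ≡ O → 1 ≤ digit p f h γ' i)
lemma1p3p3 p (suc e) _ 2<p (s≤s 0<e) h _ γ' _ _ _ (q+1∤h , _) i =
  GeneDigits.digits-of-gene p e 2<p 0<e h γ' q+1∤h (modZ<n i (2 * suc e))
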